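{- Let $m,n,s,k,c$ be positive integers such that the product $nc$ is even and $k$ is odd. If $\Gamma$ is an abelian group of order $nkc$ having exactly one involution, then there is no $\Gamma$-magic rectangle set $\mathrm{MRS}_\Gamma(m,n;s,k;c)$.
   Context: Let $m,n,s,k,c$ be positive integers and $(\Gamma,+)$ an abelian group of order $nkc$. An $\mathrm{MRS}_\Gamma(m,n;s,k;c)$ is a set of $c$ partially filled $m\times n$ arrays (some cells may be empty) with entries in $\Gamma$ such that: (a) every element of $\Gamma$ appears exactly once and in a unique array; (b) in every array each row contains exactly $s$ filled cells and each column contains exactly $k$ filled cells; (c) there exist (not necessarily distinct) $\omega,\delta\in\Gamma$ such that, in every array, the sum of the entries of each row is $\omega$ and the sum of the entries of each column is $\delta$. An involution is an element of order $2$. -}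

module Defs where

open import Level using (Level; _⊔_)
open import Data.Nat using (ℕ; zero; suc; _+_; _*_)
open import Data.Fin using (Fin; zero; suc)
open import Data.Maybe using (Maybe; just; nothing)
open import Data.Product using (Σ; ∃; _×_; _,_)
open import Relation.Binary.PropositionalEquality using (_≡_)
open import Relation.Nullary using (¬_)
open import Algebra.Bundles using (AbelianGroup)

module _ {a ℓ : Level} (G : AbelianGroup a ℓ) where
  open AbelianGroup G

  HasOrder : ℕ → Set (a ⊔ ℓ)
  HasOrder N = Σ (Fin N → Carrier) λ enum →
      (∀ i j → enum i ≈ enum j → i ≡ j)
    × (∀ g → ∃ λ i → enum i ≈ g)

  IsInvolution : Carrier → Set ℓ
  IsInvolution g = (¬ (g ≈ ε)) × (g ∙ g ≈ ε)

  ExactlyOneInvolution : Set (a ⊔ ℓ)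
  ExactlyOneInvolution = Σ Carrier λ t →
    IsInvolution t × (∀ u → IsInvolution u → u ≈ t)

  lineSum : ∀ {n} → (Fin n → Maybe Carrier) → Carrier
  lineSum {zero}  f = ε
  lineSum {suc n} f with f zero
  ... | just x  = x ∙ lineSum (λ j → f (suc j))
  ... | nothing = lineSum (λ j → f (suc j))

  filledCount : ∀ {n} → (Fin n → Maybe Carrier) → ℕ
  filledCount {zero}  f = zero
  filledCount {suc n} f with f zero
  ... | just _  = suc (filledCount (λ j → f (suc j)))
  ... | nothing = filledCount (λ j → f (suc j))

  Holds : ∀ {m n c} → (Fin c → Fin m → Fin n → Maybe Carrier) →
          Fin c → Fin m → Fin n → Carrier → Set (a ⊔ ℓ)
  Holds A b i j g = Σ Carrier λ x → (A b i j ≡ just x) × (x ≈ g)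

  -- A is an MRS_Γ(m,n;s,k;c): c partially filled m×n arrays
  -- (array b, row i, column j ↦ A b i j, nothing = empty cell).
  IsMRS : (m n s k c : ℕ) → (Fin c → Fin m → Fin n → Maybe Carrier) → Set (a ⊔ ℓ)
  IsMRS m n s k c A =
      (∀ g → Σ (Fin c) λ b → Σ (Fin m) λ i → Σ (Fin n) λ j → Holds A b i j g)
    × (∀ g b i j b' i' j' → Holds A b i j g → Holds A b' i' j' g →
         (b ≡ b') × (i ≡ i') × (j ≡ j'))
    × (∀ b i → filledCount (λ j → A b i j) ≡ s)
    × (∀ b j → filledCount (λ i → A b i j) ≡ k)
    × (Σ Carrier λ ω → Σ Carrier λ δ →
         (∀ b i → lineSum (λ j → A b i j) ≈ ω)
       × (∀ b j → lineSum (λ i → A b i j) ≈ δ))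

  MRS : (m n s k c : ℕ) → Set (a ⊔ ℓ)
  MRS m n s k c = Σ (Fin c → Fin m → Fin n → Maybe Carrier) (IsMRS m n s k c)

{-# OPTIONS --safe #-}
module Submission where

-- Pairing every element of a finite abelian group with its inverse shows
-- that the sum of all its elements is the sum of its self-inverse ones;
-- if t is the only involution this sum is t.  In an MRS every element
-- occurs in exactly one cell, so the same sum is also the sum of the
-- c n column sums, c n δ.  Multiplying by the odd k gives
-- t = k t = (n k c) δ = |Γ| δ = 0, contradicting t ≠ 0.

open import Defs
open import Level using (Level; _⊔_)
open import Data.Nat using (ℕ; zero; suc; _*_; _≤_)
open import Data.Nat.Divisibility using (_∣_; _∣0; ∣-refl; ∣m∣n⇒∣m+n)
open import Data.Nat.Solver using (module +-*-Solver)
open import Data.Fin using (Fin; zero; suc; _<_; punchIn)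
open import Data.Fin.Properties using (_≟_; _<?_; <-cmp; <-asym; punchInᵢ≢i)
open import Data.Fin.Permutation using (Permutation′; permutation)
open import Data.Maybe using (Maybe; just; nothing; fromMaybe)
open import Data.Product using (Σ; _,_; proj₁; proj₂; _×_)
open import Function using (_∘_)
open import Relation.Nullary using (¬_; Dec; yes; no; contradiction)
open import Relation.Nullary.Decidable using (map′)
open import Relation.Binary.Definitions using (Decidable; tri<; tri≈; tri>)
open import Relation.Binary.PropositionalEquality using (_≡_; _≢_)
import Relation.Binary.PropositionalEquality as ≡
open import Algebra.Bundles using (AbelianGroup)

module _ {a ℓ : Level} (G : AbelianGroup a ℓ) where
  open AbelianGroup G
  open import Algebra.Properties.CommutativeMonoid.Sum commutativeMonoid
  open import Algebra.Properties.Monoid.Mult monoid using () renaming (_×_ to _·_)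
  open import Algebra.Properties.Group group
    using (inverseˡ-unique; ⁻¹-involutive; ∙-cancelʳ; \\-leftDividesˡ; \\-leftDividesʳ)
  open import Relation.Binary.Reasoning.Setoid setoid

  when : ∀ {p} {P : Set p} → Dec P → Carrier → Carrier
  when (yes _) x = x
  when (no _)  _ = ε

  when-yes : ∀ {p} {P : Set p} (d : Dec P) {x} → P → when d x ≈ x
  when-yes (yes _) _ = refl
  when-yes (no ¬p) p = contradiction p ¬p

  when-no : ∀ {p} {P : Set p} (d : Dec P) {x} → ¬ P → when d x ≈ ε
  when-no (yes p) ¬p = contradiction p ¬p
  when-no (no _)  _  = refl

  ∑-zero : ∀ {N} (f : Fin N → Carrier) → (∀ i → f i ≈ ε) → sum f ≈ ε
  ∑-zero {N} f f≈ε = trans (sum-cong-≋ f≈ε) (sum-replicate-zero N)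

  ∑-supported : ∀ {N} (f : Fin N → Carrier) (i₀ : Fin N) →
                (∀ i → i ≢ i₀ → f i ≈ ε) → sum f ≈ f i₀
  ∑-supported {suc N} f i₀ vanishes = begin
    sum f                                  ≈⟨ sum-remove {i = i₀} f ⟩
    f i₀ ∙ sum (λ j → f (punchIn i₀ j))     ≈⟨ ∙-congˡ (∑-zero _ (λ j → vanishes _ (punchInᵢ≢i i₀ j))) ⟩
    f i₀ ∙ ε                               ≈⟨ identityʳ _ ⟩
    f i₀                                   ∎

  ∑³-supported : ∀ {p q r} (f : Fin p → Fin q → Fin r → Carrier) (x : Fin p) (y : Fin q) (z : Fin r) →
                 (∀ i j k → (i , j , k) ≢ (x , y , z) → f i j k ≈ ε) →
                 ∑[ i < p ] ∑[ j < q ] ∑[ k < r ] f i j k ≈ f x y z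
  ∑³-supported f x y z vanishes = begin
    ∑[ i < _ ] ∑[ j < _ ] ∑[ k < _ ] f i j k
      ≈⟨ ∑-supported _ x (λ i i≢x → ∑-zero _ (λ j → ∑-zero _ (λ k → vanishes i j k (i≢x ∘ ≡.cong proj₁)))) ⟩
    ∑[ j < _ ] ∑[ k < _ ] f x j k
      ≈⟨ ∑-supported _ y (λ j j≢y → ∑-zero _ (λ k → vanishes x j k (j≢y ∘ ≡.cong (proj₁ ∘ proj₂)))) ⟩
    ∑[ k < _ ] f x y k
      ≈⟨ ∑-supported _ z (λ k k≢z → vanishes x y k (k≢z ∘ ≡.cong (proj₂ ∘ proj₂))) ⟩
    f x y z ∎

  ∑-∑³-comm : ∀ {N p q r} (f : Fin N → Fin p → Fin q → Fin r → Carrier) →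
              ∑[ e < N ] ∑[ i < p ] ∑[ j < q ] ∑[ k < r ] f e i j k ≈
              ∑[ i < p ] ∑[ j < q ] ∑[ k < r ] ∑[ e < N ] f e i j k
  ∑-∑³-comm {N} {p} {q} {r} f = begin
    ∑[ e < N ] ∑[ i < p ] ∑[ j < q ] ∑[ k < r ] f e i j k
      ≈⟨ ∑-comm (λ e i → ∑[ j < q ] ∑[ k < r ] f e i j k) ⟩
    ∑[ i < p ] ∑[ e < N ] ∑[ j < q ] ∑[ k < r ] f e i j k
      ≈⟨ sum-cong-≋ (λ i → ∑-comm (λ e j → ∑[ k < r ] f e i j k)) ⟩
    ∑[ i < p ] ∑[ j < q ] ∑[ e < N ] ∑[ k < r ] f e i j k
      ≈⟨ sum-cong-≋ (λ i → sum-cong-≋ (λ j → ∑-comm (λ e k → f e i j k))) ⟩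
    ∑[ i < p ] ∑[ j < q ] ∑[ k < r ] ∑[ e < N ] f e i j k ∎

  module _ {N} (ι : Fin N → Fin N) (ι-involutive : ∀ i → ι (ι i) ≡ i) where

    ∑-pairs-cancel : (f : Fin N → Carrier) → (∀ i → f i ∙ f (ι i) ≈ ε) →
                     sum f ≈ ∑[ i < N ] when (ι i ≟ i) (f i)
    ∑-pairs-cancel f cancels = ∙-cancelʳ (sum first) (sum f) (sum fixed) (begin
      sum f ∙ sum first                    ≈⟨ ∙-congˡ (∑-permute first (permutation ι ι ι-involutive ι-involutive)) ⟩
      sum f ∙ ∑[ i < N ] first (ι i)       ≈⟨ ∑-distrib-+ f (first ∘ ι) ⟨
      ∑[ i < N ] (f i ∙ first (ι i))       ≈⟨ sum-cong-≋ regroup ⟩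
      ∑[ i < N ] (first i ∙ fixed i)       ≈⟨ ∑-distrib-+ first fixed ⟩
      sum first ∙ sum fixed                ≈⟨ comm _ _ ⟩
      sum fixed ∙ sum first                ∎)
      where
      -- first keeps f on the smaller end of each 2-cycle of ι; reindexing by ι
      -- moves it to the larger end, where regroup cancels it against f.
      first fixed : Fin N → Carrier
      first i = when (i <? ι i) (f i)
      fixed i = when (ι i ≟ i) (f i)

      first-ι-yes : ∀ {i} → ι i < i → first (ι i) ≈ f (ι i)
      first-ι-yes {i} ιi<i = when-yes (ι i <? ι (ι i)) (≡.subst (ι i <_) (≡.sym (ι-involutive i)) ιi<i)

      first-ι-no : ∀ {i} → ¬ ι i < i → first (ι i) ≈ ε
      first-ι-no {i} ιi≮i = when-no (ι i <? ι (ι i)) (ιi≮i ∘ ≡.subst (ι i <_) (ι-involutive i))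

      regroup : ∀ i → f i ∙ first (ι i) ≈ first i ∙ fixed i
      regroup i with <-cmp i (ι i)
      ... | tri< i<ιi i≢ιi _ =
        ∙-cong (sym (when-yes (i <? ι i) i<ιi))
               (trans (first-ι-no (<-asym i<ιi)) (sym (when-no (ι i ≟ i) (≡.≢-sym i≢ιi))))
      ... | tri> i≮ιi i≢ιi ιi<i = begin
        f i ∙ first (ι i)   ≈⟨ ∙-congˡ (first-ι-yes ιi<i) ⟩
        f i ∙ f (ι i)       ≈⟨ cancels i ⟩
        ε                   ≈⟨ identityˡ ε ⟨
        ε ∙ ε               ≈⟨ ∙-cong (when-no (i <? ι i) i≮ιi) (when-no (ι i ≟ i) (≡.≢-sym i≢ιi)) ⟨
        first i ∙ fixed i   ∎
      ... | tri≈ i≮ιi i≡ιi ιi≮i = begin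
        f i ∙ first (ι i)   ≈⟨ ∙-congˡ (first-ι-no ιi≮i) ⟩
        f i ∙ ε             ≈⟨ comm (f i) ε ⟩
        ε ∙ f i             ≈⟨ ∙-cong (when-no (i <? ι i) i≮ιi) (when-yes (ι i ≟ i) (≡.sym i≡ιi)) ⟨
        first i ∙ fixed i   ∎

  x∙x≈ε⇒k·x≈x : ∀ {x} → x ∙ x ≈ ε → ∀ k → ¬ (2 ∣ k) → k · x ≈ x
  x∙x≈ε⇒k·x≈x x∙x≈ε zero          k-odd = contradiction (2 ∣0) k-odd
  x∙x≈ε⇒k·x≈x x∙x≈ε (suc zero)    k-odd = identityʳ _
  x∙x≈ε⇒k·x≈x {x} x∙x≈ε (suc (suc k)) k-odd = begin
    x ∙ (x ∙ k · x)  ≈⟨ assoc x x (k · x) ⟨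
    (x ∙ x) ∙ k · x  ≈⟨ ∙-congʳ x∙x≈ε ⟩
    ε ∙ k · x        ≈⟨ identityˡ _ ⟩
    k · x            ≈⟨ x∙x≈ε⇒k·x≈x x∙x≈ε k (k-odd ∘ ∣m∣n⇒∣m+n ∣-refl) ⟩
    x                ∎

  lineSum≈∑ : ∀ {n} (f : Fin n → Maybe Carrier) → lineSum G f ≈ ∑[ j < n ] fromMaybe ε (f j)
  lineSum≈∑ {zero}  f = refl
  lineSum≈∑ {suc n} f with f zero
  ... | just x  = ∙-congˡ (lineSum≈∑ (f ∘ suc))
  ... | nothing = trans (lineSum≈∑ (f ∘ suc)) (sym (identityˡ _))

  -- Holds G A b i j g unfolds to A b i j ∋ g.
  _∋_ : Maybe Carrier → Carrier → Set (a ⊔ ℓ)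
  cell ∋ g = Σ Carrier λ x → cell ≡ just x × x ≈ g

  module Finite {N} (enum : Fin N → Carrier)
                (enum-injective : ∀ i j → enum i ≈ enum j → i ≡ j)
                (enum-surjective : ∀ g → Σ (Fin N) λ i → enum i ≈ g) where

    index : Carrier → Fin N
    index g = proj₁ (enum-surjective g)

    enum-index : ∀ g → enum (index g) ≈ g
    enum-index g = proj₂ (enum-surjective g)

    index-unique : ∀ {i g} → enum i ≈ g → i ≡ index g
    index-unique {i} {g} i↦g = enum-injective i (index g) (trans i↦g (sym (enum-index g)))

    _≈?_ : Decidable _≈_
    x ≈? y = map′ (λ same → trans (sym (enum-index x)) (trans (reflexive (≡.cong enum same)) (enum-index y)))
                  (λ x≈y → index-unique (trans (enum-index x) x≈y))
                  (index x ≟ index y)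

    _∋?_ : ∀ cell g → Dec (cell ∋ g)
    nothing ∋? g = no λ ()
    just x  ∋? g = map′ (λ x≈g → x , ≡.refl , x≈g) (λ { (_ , ≡.refl , x≈g) → x≈g }) (x ≈? g)

    transport : (Carrier → Carrier) → Fin N → Fin N
    transport h i = index (h (enum i))

    transport-inverse : ∀ {h h′} → (∀ {x y} → x ≈ y → h x ≈ h y) → (∀ g → h (h′ g) ≈ g) →
                        ∀ i → transport h (transport h′ i) ≡ i
    transport-inverse {h} {h′} h-cong h∘h′≈id i =
      ≡.sym (index-unique (sym (trans (h-cong (enum-index (h′ (enum i)))) (h∘h′≈id (enum i)))))

    N·x≈ε : ∀ x → N · x ≈ ε
    N·x≈ε x = ∙-cancelʳ (sum enum) (N · x) ε (begin
      N · x ∙ sum enum                   ≈⟨ ∙-congʳ (sum-replicate N) ⟨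
      ∑[ i < N ] x ∙ sum enum            ≈⟨ ∑-distrib-+ (λ _ → x) enum ⟨
      ∑[ i < N ] (x ∙ enum i)            ≈⟨ sum-cong-≋ (λ i → enum-index (x ∙ enum i)) ⟨
      ∑[ i < N ] enum (translate i)      ≈⟨ ∑-permute enum translation ⟨
      sum enum                           ≈⟨ identityˡ _ ⟨
      ε ∙ sum enum                       ∎)
      where
      translate : Fin N → Fin N
      translate = transport (x ∙_)
      translation : Permutation′ N
      translation = permutation translate (transport (x ⁻¹ ∙_))
        (transport-inverse ∙-congˡ (\\-leftDividesˡ x)) (transport-inverse ∙-congˡ (\\-leftDividesʳ x))

    ∑-enum≈involution : (t! : ExactlyOneInvolution G) → sum enum ≈ proj₁ t!
    ∑-enum≈involution (t , (_ , t∙t≈ε) , unique) = begin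
      sum enum                                         ≈⟨ ∑-pairs-cancel ι ι-involutive enum enum∙enum-ι≈ε ⟩
      ∑[ i < N ] when (ι i ≟ i) (enum i)               ≈⟨ ∑-supported _ (index t) fixed-elsewhere-vanishes ⟩
      when (ι (index t) ≟ index t) (enum (index t))    ≈⟨ when-yes (ι (index t) ≟ index t) ι-fixes-t ⟩
      enum (index t)                                   ≈⟨ enum-index t ⟩
      t                                                ∎
      where
      ι : Fin N → Fin N
      ι = transport _⁻¹

      ι-involutive : ∀ i → ι (ι i) ≡ i
      ι-involutive = transport-inverse ⁻¹-cong ⁻¹-involutive

      enum∙enum-ι≈ε : ∀ i → enum i ∙ enum (ι i) ≈ ε
      enum∙enum-ι≈ε i = trans (∙-congˡ (enum-index (enum i ⁻¹))) (inverseʳ (enum i))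

      ι-fixes-t : ι (index t) ≡ index t
      ι-fixes-t = ≡.sym (index-unique (begin
        enum (index t)       ≈⟨ enum-index t ⟩
        t                    ≈⟨ inverseˡ-unique t t t∙t≈ε ⟩
        t ⁻¹                 ≈⟨ ⁻¹-cong (enum-index t) ⟨
        enum (index t) ⁻¹    ∎))

      fixed-elsewhere-vanishes : ∀ i → i ≢ index t → when (ι i ≟ i) (enum i) ≈ ε
      fixed-elsewhere-vanishes i i≢t with ι i ≟ i
      ... | no _     = refl
      ... | yes ιi≡i with enum i ≈? ε
      ...   | yes i↦ε = i↦ε
      ...   | no i↦̸ε = contradiction (index-unique (unique (enum i) (i↦̸ε , self-inverse))) i≢t
        where
        self-inverse : enum i ∙ enum i ≈ ε
        self-inverse = trans (∙-congˡ (reflexive (≡.cong enum (≡.sym ιi≡i)))) (enum∙enum-ι≈ε i)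

    ∑-occurrences≈fromMaybe : ∀ cell → ∑[ e < N ] when (cell ∋? enum e) (enum e) ≈ fromMaybe ε cell
    ∑-occurrences≈fromMaybe nothing  = ∑-zero {N} _ (λ _ → refl)
    ∑-occurrences≈fromMaybe (just x) = begin
      ∑[ e < N ] when (just x ∋? enum e) (enum e)       ≈⟨ ∑-supported _ (index x) elsewhere-vanishes ⟩
      when (just x ∋? enum (index x)) (enum (index x))  ≈⟨ when-yes (just x ∋? _) (x , ≡.refl , sym (enum-index x)) ⟩
      enum (index x)                                    ≈⟨ enum-index x ⟩
      x                                                 ∎
      where
      elsewhere-vanishes : ∀ e → e ≢ index x → when (just x ∋? enum e) (enum e) ≈ ε
      elsewhere-vanishes e e≢x = when-no (just x ∋? enum e) λ { (_ , ≡.refl , x≈e) → e≢x (index-unique (sym x≈e)) }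

    module _ {m n c} (A : Fin c → Fin m → Fin n → Maybe Carrier)
             (covers : ∀ g → Σ (Fin c) λ b → Σ (Fin m) λ i → Σ (Fin n) λ j → Holds G A b i j g)
             (once : ∀ g b i j b′ i′ j′ → Holds G A b i j g → Holds G A b′ i′ j′ g →
                       (b ≡ b′) × (i ≡ i′) × (j ≡ j′)) where

      ∑-cells-occurrences≈enum : ∀ e → ∑[ b < c ] ∑[ j < n ] ∑[ i < m ] when (A b i j ∋? enum e) (enum e) ≈ enum e
      ∑-cells-occurrences≈enum e with covers (enum e)
      ... | b₀ , i₀ , j₀ , e∈A₀ =
        trans (∑³-supported _ b₀ j₀ i₀ elsewhere-vanishes) (when-yes (A b₀ i₀ j₀ ∋? enum e) e∈A₀)
        where
        elsewhere-vanishes : ∀ b j i → (b , j , i) ≢ (b₀ , j₀ , i₀) → when (A b i j ∋? enum e) (enum e) ≈ ε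
        elsewhere-vanishes b j i elsewhere = when-no (A b i j ∋? enum e) λ e∈A →
          elsewhere (same-cell (once (enum e) b i j b₀ i₀ j₀ e∈A e∈A₀))
          where
          same-cell : (b ≡ b₀) × (i ≡ i₀) × (j ≡ j₀) → (b , j , i) ≡ (b₀ , j₀ , i₀)
          same-cell (≡.refl , ≡.refl , ≡.refl) = ≡.refl

      ∑-enum≈∑-cells : sum enum ≈ ∑[ b < c ] ∑[ j < n ] ∑[ i < m ] fromMaybe ε (A b i j)
      ∑-enum≈∑-cells = begin
        sum enum
          ≈⟨ sum-cong-≋ ∑-cells-occurrences≈enum ⟨
        ∑[ e < N ] ∑[ b < c ] ∑[ j < n ] ∑[ i < m ] when (A b i j ∋? enum e) (enum e)
          ≈⟨ ∑-∑³-comm (λ e b j i → when (A b i j ∋? enum e) (enum e)) ⟩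
        ∑[ b < c ] ∑[ j < n ] ∑[ i < m ] ∑[ e < N ] when (A b i j ∋? enum e) (enum e)
          ≈⟨ sum-cong-≋ (λ b → sum-cong-≋ (λ j → sum-cong-≋ (λ i → ∑-occurrences≈fromMaybe (A b i j)))) ⟩
        ∑[ b < c ] ∑[ j < n ] ∑[ i < m ] fromMaybe ε (A b i j) ∎

      ∑-enum≈c·n·δ : ∀ {δ} → (∀ b j → lineSum G (λ i → A b i j) ≈ δ) → sum enum ≈ c · (n · δ)
      ∑-enum≈c·n·δ {δ} column-sums = begin
        sum enum                                                ≈⟨ ∑-enum≈∑-cells ⟩
        ∑[ b < c ] ∑[ j < n ] ∑[ i < m ] fromMaybe ε (A b i j)   ≈⟨ sum-cong-≋ {c} (λ b → sum-cong-≋ {n} (λ j →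
                                                                     trans (sym (lineSum≈∑ (λ i → A b i j))) (column-sums b j))) ⟩
        ∑[ b < c ] ∑[ j < n ] δ                                 ≈⟨ sum-cong-≋ {c} (λ _ → sum-replicate n) ⟩
        ∑[ b < c ] (n · δ)                                      ≈⟨ sum-replicate c ⟩
        c · (n · δ)                                             ∎

lemma3p6 : {a ℓ : Level} (m n s k c : ℕ) →
    1 ≤ m → 1 ≤ n → 1 ≤ s → 1 ≤ k → 1 ≤ c →
    2 ∣ n * c → ¬ (2 ∣ k) →
    (G : AbelianGroup a ℓ) → HasOrder G (n * k * c) → ExactlyOneInvolution G →
    ¬ MRS G m n s k c
lemma3p6 m n s k c _ _ _ _ _ _ k-odd G (enum , enum-injective , enum-surjective) t!@(t , (t≉ε , t∙t≈ε) , _)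
         (A , covers , once , _ , _ , _ , δ , _ , column-sums) = t≉ε (begin
  t                         ≈⟨ x∙x≈ε⇒k·x≈x G t∙t≈ε k k-odd ⟨
  k · t                     ≈⟨ ×-congʳ k (∑-enum≈involution t!) ⟨
  k · sum enum              ≈⟨ ×-congʳ k (∑-enum≈c·n·δ A covers once column-sums) ⟩
  k · (c · (n · δ))         ≈⟨ ×-congʳ k (×-assocˡ δ c n) ⟩
  k · ((c * n) · δ)         ≈⟨ ×-assocˡ δ k (c * n) ⟩
  (k * (c * n)) · δ         ≈⟨ ×-congˡ (solve 3 (λ n k c → k :* (c :* n) := n :* k :* c) ≡.refl n k c) ⟩
  (n * k * c) · δ           ≈⟨ N·x≈ε δ ⟩
  ε                         ∎)
  where
  open AbelianGroup G
  open Finite G enum enum-injective enum-surjective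
  open import Algebra.Properties.Monoid.Mult monoid using (×-congʳ; ×-congˡ; ×-assocˡ) renaming (_×_ to _·_)
  open import Algebra.Properties.CommutativeMonoid.Sum commutativeMonoid using (sum)
  open import Relation.Binary.Reasoning.Setoid setoid
  open +-*-Solver
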